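{- Let $D(x_1,\ldots,x_n)\in\mathbb{Z}[x_1,\ldots,x_n]$ be a polynomial such that the set of integer solutions of $D(x_1,\ldots,x_n)=0$ is non-empty and finite, and let $d$ denote the maximal height of an integer solution of this equation. Then the number of integer solutions $(x_1,\ldots,x_n,s_1,s_2,s_3,s_4,t_1,t_2,t_3,t_4)\in\mathbb{Z}^{n+8}$ of the equation \[ D^2(x_1,\ldots,x_n)+\left(x_1^2+\ldots+x_n^2-s_1^2-s_2^2-s_3^2-s_4^2-t_1^2-t_2^2-t_3^2-t_4^2\right)^2=0 \] is finite and greater than $d$.
   Context: The height of an integer tuple $(a_1,\ldots,a_n)$ is $\max(|a_1|,\ldots,|a_n|)$. -}

module Defs where

open import Data.Nat using (ℕ; _⊔_; _+_)
open import Data.Integer as ℤ using (ℤ; ∣_∣)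
open import Data.Fin using (Fin)
open import Data.Vec using (Vec; lookup; foldr′; map; splitAt)
open import Data.Product using (_×_; _,_; Σ; ∃)
open import Relation.Binary.PropositionalEquality using (_≡_)

-- Polynomials in Z[x_1,...,x_n], represented syntactically
-- (every polynomial is built from integer constants and variables by + and *).
data Poly (n : ℕ) : Set where
  const : ℤ → Poly n
  var   : Fin n → Poly n
  _⊕_   : Poly n → Poly n → Poly n
  _⊗_   : Poly n → Poly n → Poly n

eval : {n : ℕ} → Poly n → Vec ℤ n → ℤ
eval (const c) x = c
eval (var i)   x = lookup x i
eval (p ⊕ q)   x = eval p x ℤ.+ eval q x
eval (p ⊗ q)   x = eval p x ℤ.* eval q x

-- Height of an integer tuple: max |a_i| (0 for the empty tuple).
height : {n : ℕ} → Vec ℤ n → ℕ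
height v = foldr′ (λ a m → ∣ a ∣ ⊔ m) 0 v

sumSq : {n : ℕ} → Vec ℤ n → ℤ
sumSq v = foldr′ (λ a s → a ℤ.* a ℤ.+ s) (ℤ.+ 0) v

E : {n : ℕ} → Poly n → Vec ℤ (n + 8) → ℤ
E {n} D y with splitAt n y
... | x , st , _ with splitAt 4 st
...   | s , t , _ =
  let a = eval D x
      b = sumSq x ℤ.- sumSq s ℤ.- sumSq t
  in a ℤ.* a ℤ.+ b ℤ.* b

module Submission where

-- Let D ∈ ℤ[x₁,…,xₙ] have a root x₀ of height d, and let E = D² + (‖x‖² − ‖s‖² − ‖t‖²)²
-- on ℤⁿ⁺⁸.  The zeros of E are the vectors x ++ s ++ t with D(x) = 0 and ‖x‖² = ‖s‖² + ‖t‖².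
--
-- Finiteness: for each of the finitely many roots x, the entries of s and t are bounded by
-- ‖x‖², so all zeros of E lie in an explicit finite list of candidates; filtering it by the
-- decidable condition E = 0 and removing duplicates lists the zeros exactly once.
--
-- Counting: for 0 ≤ k ≤ d we have k² ≤ d² ≤ ‖x₀‖², and by Lagrange's four-square theorem
-- ‖x₀‖² − k² = ‖tₖ‖² for some tₖ ∈ ℤ⁴.  Then x₀ ++ (k,0,0,0) ++ tₖ are d + 1 distinct zeros.

module Lagrange where
  open import Data.Nat as ℕ using (ℕ; zero; suc; z≤n; s≤s; z<s)
  import Data.Nat.Properties as ℕP
  open import Data.Nat.Divisibility as Div using (divides; >⇒∤; quotient-<)
  open import Data.Nat.Divisibility.Core using (hasNonTrivialDivisor)
  open import Data.Nat.Primality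
    using (Prime; prime; ¬prime[1]; composite?; prime⇒irreducible; prime⇒nonZero; euclidsLemma)
  open import Data.Nat.Induction using (<-rec)
  import Data.Nat.Tactic.RingSolver as ℕSolver
  open import Data.Integer as ℤ using (ℤ; +_; ∣_∣; _+_; _-_; _*_; -_; 0ℤ; 1ℤ)
  import Data.Integer.Properties as ℤP
  open import Data.Integer.DivMod using (_%ℕ_; _/ℕ_; a≡a%ℕn+[a/ℕn]*n; n%ℕd<d)
  open import Data.Integer.Tactic.RingSolver using (solve-∀)
  open import Data.Fin as Fin using (Fin; toℕ; fromℕ<)
  import Data.Fin.Properties as FinP
  open import Data.Product using (Σ; ∃; ∃₂; _×_; _,_)
  open import Data.Sum as Sum using (_⊎_; inj₁; inj₂; [_,_]′)
  open import Data.Empty using (⊥-elim)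
  open import Relation.Nullary using (yes; no)
  open import Relation.Binary.PropositionalEquality
  open ≡-Reasoning

  Q : ℤ → ℤ → ℤ → ℤ → ℤ
  Q a b c d = a * a + b * b + c * c + d * d

  FourSquares : ℤ → Set
  FourSquares z = Σ ℤ λ a → Σ ℤ λ b → Σ ℤ λ c → Σ ℤ λ d → Q a b c d ≡ z

  four-squares-* : ∀ {z w} → FourSquares z → FourSquares w → FourSquares (z * w)
  four-squares-* (a₁ , a₂ , a₃ , a₄ , refl) (b₁ , b₂ , b₃ , b₄ , refl) =
    a₁ * b₁ + a₂ * b₂ + a₃ * b₃ + a₄ * b₄ ,
    a₁ * b₂ - a₂ * b₁ + a₃ * b₄ - a₄ * b₃ ,
    a₁ * b₃ - a₂ * b₄ - a₃ * b₁ + a₄ * b₂ ,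
    a₁ * b₄ + a₂ * b₃ - a₃ * b₂ - a₄ * b₁ ,
    sym (euler a₁ a₂ a₃ a₄ b₁ b₂ b₃ b₄)
    where
    euler : ∀ a₁ a₂ a₃ a₄ b₁ b₂ b₃ b₄ →
      (a₁ * a₁ + a₂ * a₂ + a₃ * a₃ + a₄ * a₄) * (b₁ * b₁ + b₂ * b₂ + b₃ * b₃ + b₄ * b₄)
      ≡ (a₁ * b₁ + a₂ * b₂ + a₃ * b₃ + a₄ * b₄) * (a₁ * b₁ + a₂ * b₂ + a₃ * b₃ + a₄ * b₄)
      + (a₁ * b₂ - a₂ * b₁ + a₃ * b₄ - a₄ * b₃) * (a₁ * b₂ - a₂ * b₁ + a₃ * b₄ - a₄ * b₃)
      + (a₁ * b₃ - a₂ * b₄ - a₃ * b₁ + a₄ * b₂) * (a₁ * b₃ - a₂ * b₄ - a₃ * b₁ + a₄ * b₂)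
      + (a₁ * b₄ + a₂ * b₃ - a₃ * b₂ - a₄ * b₁) * (a₁ * b₄ + a₂ * b₃ - a₃ * b₂ - a₄ * b₁)
    euler = solve-∀

  square-abs : ∀ a → a * a ≡ + (∣ a ∣ ℕ.* ∣ a ∣)
  square-abs (+ n)     = sym (ℤP.pos-* n n)
  square-abs (ℤ.-[1+ n ]) = refl

  equal-remainders : ∀ a b m .{{_ : ℕ.NonZero m}} →
    a %ℕ m ≡ b %ℕ m → a - b ≡ (a /ℕ m - b /ℕ m) * + m
  equal-remainders a b m same = begin
    a - b
      ≡⟨ cong₂ _-_ (a≡a%ℕn+[a/ℕn]*n a m) (a≡a%ℕn+[a/ℕn]*n b m) ⟩
    (+ (a %ℕ m) + a /ℕ m * + m) - (+ (b %ℕ m) + b /ℕ m * + m)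
      ≡⟨ cong (λ r → (+ r + a /ℕ m * + m) - (+ (b %ℕ m) + b /ℕ m * + m)) same ⟩
    (+ (b %ℕ m) + a /ℕ m * + m) - (+ (b %ℕ m) + b /ℕ m * + m)
      ≡⟨ difference (+ (b %ℕ m)) (a /ℕ m) (b /ℕ m) (+ m) ⟩
    (a /ℕ m - b /ℕ m) * + m ∎
    where
    difference : ∀ r s t m → (r + s * m) - (r + t * m) ≡ (s - t) * m
    difference = solve-∀

  -- y is a least absolute residue modulo m: -m/2 < y ≤ m/2.
  LeastResidue : ℕ → ℤ → Set
  LeastResidue m y = ∣ y ∣ ℕ.+ ∣ y ∣ ℕ.≤ m × (∣ y ∣ ℕ.+ ∣ y ∣ ≡ m → y ≡ + ∣ y ∣)

  least-residue : ∀ x m .{{_ : ℕ.NonZero m}} →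
    ∃₂ λ y q → x ≡ y + q * + m × LeastResidue m y
  least-residue x m with x %ℕ m ℕ.+ x %ℕ m ℕ.≤? m
  ... | yes r+r≤m = + (x %ℕ m) , x /ℕ m , a≡a%ℕn+[a/ℕn]*n x m , r+r≤m , λ _ → refl
  ... | no r+r≰m  = - + k , x /ℕ m + 1ℤ , x≡ , k+k≤m , λ k+k≡m → ⊥-elim (ℕP.<-irrefl k+k≡m k+k<m)
    where
    r k : ℕ
    r = x %ℕ m
    k = m ℕ.∸ r
    r+k≡m : r ℕ.+ k ≡ m
    r+k≡m = ℕP.m+[n∸m]≡n (ℕP.<⇒≤ (n%ℕd<d x m))
    k<r : k ℕ.< r
    k<r = ℕP.+-cancelˡ-< r k r (subst (ℕ._< r ℕ.+ r) (sym r+k≡m) (ℕP.≰⇒> r+r≰m))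
    k+k<m : ∣ - + k ∣ ℕ.+ ∣ - + k ∣ ℕ.< m
    k+k<m = subst (λ j → j ℕ.+ j ℕ.< m) (sym (ℤP.∣-i∣≡∣i∣ (+ k)))
              (subst (k ℕ.+ k ℕ.<_) r+k≡m (ℕP.+-monoˡ-< k k<r))
    k+k≤m : ∣ - + k ∣ ℕ.+ ∣ - + k ∣ ℕ.≤ m
    k+k≤m = ℕP.<⇒≤ k+k<m
    shift : ∀ r k q → r + q * (r + k) ≡ - k + (q + 1ℤ) * (r + k)
    shift = solve-∀
    x≡ : x ≡ - + k + (x /ℕ m + 1ℤ) * + m
    x≡ = begin
      x                                      ≡⟨ a≡a%ℕn+[a/ℕn]*n x m ⟩
      + r + x /ℕ m * + m                     ≡⟨ cong (λ j → + r + x /ℕ m * j) m≡ ⟩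
      + r + x /ℕ m * (+ r + + k)             ≡⟨ shift (+ r) (+ k) (x /ℕ m) ⟩
      - + k + (x /ℕ m + 1ℤ) * (+ r + + k)    ≡⟨ cong (λ j → - + k + (x /ℕ m + 1ℤ) * j) (sym m≡) ⟩
      - + k + (x /ℕ m + 1ℤ) * + m ∎
      where
      m≡ : + m ≡ + r + + k
      m≡ = trans (cong +_ (sym r+k≡m)) (ℤP.pos-+ r k)

  Qℕ : ℕ → ℕ → ℕ → ℕ → ℕ
  Qℕ a b c d = a ℕ.* a ℕ.+ b ℕ.* b ℕ.+ c ℕ.* c ℕ.+ d ℕ.* d

  square-mono-≤ : ∀ {a b} → a ℕ.≤ b → a ℕ.* a ℕ.≤ b ℕ.* b
  square-mono-≤ a≤b = ℕP.*-mono-≤ a≤b a≤b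

  normQ : ℤ → ℤ → ℤ → ℤ → ℕ
  normQ a b c d = Qℕ (∣ a ∣) (∣ b ∣) (∣ c ∣) (∣ d ∣)

  Q-abs : ∀ a b c d → Q a b c d ≡ + normQ a b c d
  Q-abs a b c d = begin
    Q a b c d
      ≡⟨ cong₂ _+_ (cong₂ _+_ (cong₂ _+_ (square-abs a) (square-abs b)) (square-abs c)) (square-abs d) ⟩
    + A + + B + + C + + D
      ≡⟨ cong (_+ + D) (cong (_+ + C) (sym (ℤP.pos-+ A B))) ⟩
    + (A ℕ.+ B) + + C + + D
      ≡⟨ cong (_+ + D) (sym (ℤP.pos-+ (A ℕ.+ B) C)) ⟩
    + (A ℕ.+ B ℕ.+ C) + + D
      ≡⟨ sym (ℤP.pos-+ (A ℕ.+ B ℕ.+ C) D) ⟩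
    + normQ a b c d ∎
    where
    A B C D : ℕ
    A = ∣ a ∣ ℕ.* ∣ a ∣
    B = ∣ b ∣ ℕ.* ∣ b ∣
    C = ∣ c ∣ ℕ.* ∣ c ∣
    D = ∣ d ∣ ℕ.* ∣ d ∣

  Qℕ-double : ∀ a b c d → 4 ℕ.* Qℕ a b c d ≡ Qℕ (a ℕ.+ a) (b ℕ.+ b) (c ℕ.+ c) (d ℕ.+ d)
  Qℕ-double = identity
    where
    identity : ∀ a b c d → 4 ℕ.* (a ℕ.* a ℕ.+ b ℕ.* b ℕ.+ c ℕ.* c ℕ.+ d ℕ.* d)
      ≡ (a ℕ.+ a) ℕ.* (a ℕ.+ a) ℕ.+ (b ℕ.+ b) ℕ.* (b ℕ.+ b)
        ℕ.+ (c ℕ.+ c) ℕ.* (c ℕ.+ c) ℕ.+ (d ℕ.+ d) ℕ.* (d ℕ.+ d)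
    identity = ℕSolver.solve-∀

  Qℕ-diagonal : ∀ m → 4 ℕ.* (m ℕ.* m) ≡ Qℕ m m m m
  Qℕ-diagonal = identity
    where
    identity : ∀ m → 4 ℕ.* (m ℕ.* m) ≡ m ℕ.* m ℕ.+ m ℕ.* m ℕ.+ m ℕ.* m ℕ.+ m ℕ.* m
    identity = ℕSolver.solve-∀

  residues-bound : ∀ {m y₁ y₂ y₃ y₄} →
    LeastResidue m y₁ → LeastResidue m y₂ → LeastResidue m y₃ → LeastResidue m y₄ →
    normQ y₁ y₂ y₃ y₄ ℕ.≤ m ℕ.* m
  residues-bound {m} {y₁} {y₂} {y₃} {y₄} (b₁ , _) (b₂ , _) (b₃ , _) (b₄ , _) =
    ℕP.*-cancelˡ-≤ 4 (subst₂ ℕ._≤_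
      (sym (Qℕ-double (∣ y₁ ∣) (∣ y₂ ∣) (∣ y₃ ∣) (∣ y₄ ∣))) (sym (Qℕ-diagonal m))
      (ℕP.+-mono-≤ (ℕP.+-mono-≤ (ℕP.+-mono-≤ (square-mono-≤ b₁) (square-mono-≤ b₂))
        (square-mono-≤ b₃)) (square-mono-≤ b₄)))

  Qℕ-zero : ∀ a b c d → Qℕ a b c d ≡ 0 → a ≡ 0 × b ≡ 0 × c ≡ 0 × d ≡ 0
  Qℕ-zero zero zero zero zero _ = refl , refl , refl , refl

  Qℕ-tight : ∀ {m} a b c d → a ℕ.≤ m → b ℕ.≤ m → c ℕ.≤ m → d ℕ.≤ m →
    Qℕ a b c d ≡ Qℕ m m m m → a ≡ m × b ≡ m × c ≡ m × d ≡ m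
  Qℕ-tight {m} a b c d a≤m b≤m c≤m d≤m eq =
    let abc≡ , d²≡ = +-tight (ℕP.+-mono-≤ (ℕP.+-mono-≤ a²≤ b²≤) c²≤) d²≤ eq
        ab≡ , c²≡  = +-tight (ℕP.+-mono-≤ a²≤ b²≤) c²≤ abc≡
        a²≡ , b²≡  = +-tight a²≤ b²≤ ab≡
    in root a≤m a²≡ , root b≤m b²≡ , root c≤m c²≡ , root d≤m d²≡
    where
    a²≤ : a ℕ.* a ℕ.≤ m ℕ.* m
    b²≤ : b ℕ.* b ℕ.≤ m ℕ.* m
    c²≤ : c ℕ.* c ℕ.≤ m ℕ.* m
    d²≤ : d ℕ.* d ℕ.≤ m ℕ.* m
    a²≤ = square-mono-≤ a≤m
    b²≤ = square-mono-≤ b≤m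
    c²≤ = square-mono-≤ c≤m
    d²≤ = square-mono-≤ d≤m
    +-tight : ∀ {a b c d} → a ℕ.≤ c → b ℕ.≤ d → a ℕ.+ b ≡ c ℕ.+ d → a ≡ c × b ≡ d
    +-tight {a} {b} {c} {d} a≤c b≤d eq with ℕP.m≤n⇒m<n∨m≡n a≤c
    ... | inj₁ a<c = ⊥-elim (ℕP.<-irrefl eq (ℕP.+-mono-<-≤ a<c b≤d))
    ... | inj₂ refl = refl , ℕP.+-cancelˡ-≡ a b d eq
    root : ∀ {a m} → a ℕ.≤ m → a ℕ.* a ≡ m ℕ.* m → a ≡ m
    root a≤m a²≡m² with ℕP.m≤n⇒m<n∨m≡n a≤m
    ... | inj₁ a<m = ⊥-elim (ℕP.<-irrefl a²≡m² (ℕP.*-mono-< a<m a<m))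
    ... | inj₂ a≡m = a≡m

  -- If x₁, …, x₄ are all congruent to c modulo M, where 2c = e·M, then M² divides Q x.
  common-residue : ∀ c e q₁ q₂ q₃ q₄ M → c + c ≡ e * M →
    Q (c + q₁ * M) (c + q₂ * M) (c + q₃ * M) (c + q₄ * M)
      ≡ M * (M * (e * e + e * (q₁ + q₂ + q₃ + q₄) + Q q₁ q₂ q₃ q₄))
  common-residue c e q₁ q₂ q₃ q₄ M 2c≡eM = begin
    Q (c + q₁ * M) (c + q₂ * M) (c + q₃ * M) (c + q₄ * M)
      ≡⟨ expand c e q₁ q₂ q₃ q₄ M ⟩
    M * (M * K) + (c + c - e * M) * (c + c + e * M + M * Σq)
      ≡⟨ cong (λ z → M * (M * K) + (z - e * M) * (z + e * M + M * Σq)) 2c≡eM ⟩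
    M * (M * K) + (e * M - e * M) * (e * M + e * M + M * Σq)
      ≡⟨ vanish (M * (M * K)) (e * M) (e * M + e * M + M * Σq) ⟩
    M * (M * K) ∎
    where
    Σq K : ℤ
    Σq = q₁ + q₂ + q₃ + q₄
    K = e * e + e * Σq + Q q₁ q₂ q₃ q₄
    expand : ∀ c e q₁ q₂ q₃ q₄ M →
      (c + q₁ * M) * (c + q₁ * M) + (c + q₂ * M) * (c + q₂ * M)
        + (c + q₃ * M) * (c + q₃ * M) + (c + q₄ * M) * (c + q₄ * M)
      ≡ M * (M * (e * e + e * (q₁ + q₂ + q₃ + q₄) + (q₁ * q₁ + q₂ * q₂ + q₃ * q₃ + q₄ * q₄)))
        + (c + c - e * M) * (c + c + e * M + M * (q₁ + q₂ + q₃ + q₄))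
    expand = solve-∀
    vanish : ∀ X a Y → X + (a - a) * Y ≡ X
    vanish = solve-∀

  shifted-multiple : ∀ y₁ y₂ y₃ y₄ q₁ q₂ q₃ q₄ M P →
    Q (y₁ + q₁ * M) (y₂ + q₂ * M) (y₃ + q₃ * M) (y₄ + q₄ * M) ≡ M * P →
    ∃ λ R → Q y₁ y₂ y₃ y₄ ≡ M * R
  shifted-multiple y₁ y₂ y₃ y₄ q₁ q₂ q₃ q₄ M P Qx≡MP = P - T , (begin
    Q y₁ y₂ y₃ y₄                   ≡⟨ expand y₁ y₂ y₃ y₄ q₁ q₂ q₃ q₄ M ⟩
    Q x₁ x₂ x₃ x₄ - M * T           ≡⟨ cong (_- M * T) Qx≡MP ⟩
    M * P - M * T                   ≡⟨ distrib M P T ⟨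
    M * (P - T)                     ∎)
    where
    x₁ x₂ x₃ x₄ T : ℤ
    x₁ = y₁ + q₁ * M
    x₂ = y₂ + q₂ * M
    x₃ = y₃ + q₃ * M
    x₄ = y₄ + q₄ * M
    T = (y₁ * q₁ + y₁ * q₁ + q₁ * q₁ * M) + (y₂ * q₂ + y₂ * q₂ + q₂ * q₂ * M)
      + (y₃ * q₃ + y₃ * q₃ + q₃ * q₃ * M) + (y₄ * q₄ + y₄ * q₄ + q₄ * q₄ * M)
    expand : ∀ y₁ y₂ y₃ y₄ q₁ q₂ q₃ q₄ M →
      y₁ * y₁ + y₂ * y₂ + y₃ * y₃ + y₄ * y₄
      ≡ (y₁ + q₁ * M) * (y₁ + q₁ * M) + (y₂ + q₂ * M) * (y₂ + q₂ * M)
        + (y₃ + q₃ * M) * (y₃ + q₃ * M) + (y₄ + q₄ * M) * (y₄ + q₄ * M)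
        - M * ((y₁ * q₁ + y₁ * q₁ + q₁ * q₁ * M) + (y₂ * q₂ + y₂ * q₂ + q₂ * q₂ * M)
             + (y₃ * q₃ + y₃ * q₃ + q₃ * q₃ * M) + (y₄ * q₄ + y₄ * q₄ + q₄ * q₄ * M))
    expand = solve-∀
    distrib : ∀ M P T → M * (P - T) ≡ M * P - M * T
    distrib = solve-∀

  -- Euler's identity applied to x = y + q·M and y: if Q x = M·P and Q y = M·R with M ≠ 0,
  -- then R·P is a sum of four squares.
  descent-identity : ∀ y₁ y₂ y₃ y₄ q₁ q₂ q₃ q₄ M P R .{{_ : ℤ.NonZero M}} →
    Q (y₁ + q₁ * M) (y₂ + q₂ * M) (y₃ + q₃ * M) (y₄ + q₄ * M) ≡ M * P →
    Q y₁ y₂ y₃ y₄ ≡ M * R → FourSquares (R * P)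
  descent-identity y₁ y₂ y₃ y₄ q₁ q₂ q₃ q₄ M P R Qx≡MP Qy≡MR =
    R + S , w₂ , w₃ , w₄ ,
    ℤP.*-cancelˡ-≡ M _ _ (ℤP.*-cancelˡ-≡ M _ _ (sym (begin
      M * (M * (R * P))                            ≡⟨ regroup M P R ⟩
      (M * P) * (M * R)                            ≡⟨ cong₂ _*_ Qx≡MP Qy≡MR ⟨
      Q x₁ x₂ x₃ x₄ * Q y₁ y₂ y₃ y₄                 ≡⟨ euler y₁ y₂ y₃ y₄ q₁ q₂ q₃ q₄ M ⟩
      (Qy + M * S) * (Qy + M * S) + M * (M * W)
        ≡⟨ cong (λ z → (z + M * S) * (z + M * S) + M * (M * W)) Qy≡MR ⟩
      (M * R + M * S) * (M * R + M * S) + M * (M * W) ≡⟨ factor M R S w₂ w₃ w₄ ⟩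
      M * (M * Q (R + S) w₂ w₃ w₄)                 ∎)))
    where
    x₁ x₂ x₃ x₄ Qy S w₂ w₃ w₄ W : ℤ
    x₁ = y₁ + q₁ * M
    x₂ = y₂ + q₂ * M
    x₃ = y₃ + q₃ * M
    x₄ = y₄ + q₄ * M
    Qy = Q y₁ y₂ y₃ y₄
    S  = q₁ * y₁ + q₂ * y₂ + q₃ * y₃ + q₄ * y₄
    w₂ = q₁ * y₂ - q₂ * y₁ + q₃ * y₄ - q₄ * y₃
    w₃ = q₁ * y₃ - q₂ * y₄ - q₃ * y₁ + q₄ * y₂
    w₄ = q₁ * y₄ + q₂ * y₃ - q₃ * y₂ - q₄ * y₁
    W  = w₂ * w₂ + w₃ * w₃ + w₄ * w₄
    regroup : ∀ M P R → M * (M * (R * P)) ≡ (M * P) * (M * R)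
    regroup = solve-∀
    euler : ∀ y₁ y₂ y₃ y₄ q₁ q₂ q₃ q₄ M →
      ((y₁ + q₁ * M) * (y₁ + q₁ * M) + (y₂ + q₂ * M) * (y₂ + q₂ * M)
        + (y₃ + q₃ * M) * (y₃ + q₃ * M) + (y₄ + q₄ * M) * (y₄ + q₄ * M))
      * (y₁ * y₁ + y₂ * y₂ + y₃ * y₃ + y₄ * y₄)
      ≡ ((y₁ * y₁ + y₂ * y₂ + y₃ * y₃ + y₄ * y₄) + M * (q₁ * y₁ + q₂ * y₂ + q₃ * y₃ + q₄ * y₄))
        * ((y₁ * y₁ + y₂ * y₂ + y₃ * y₃ + y₄ * y₄) + M * (q₁ * y₁ + q₂ * y₂ + q₃ * y₃ + q₄ * y₄))
      + M * (M * ((q₁ * y₂ - q₂ * y₁ + q₃ * y₄ - q₄ * y₃) * (q₁ * y₂ - q₂ * y₁ + q₃ * y₄ - q₄ * y₃)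
               + (q₁ * y₃ - q₂ * y₄ - q₃ * y₁ + q₄ * y₂) * (q₁ * y₃ - q₂ * y₄ - q₃ * y₁ + q₄ * y₂)
               + (q₁ * y₄ + q₂ * y₃ - q₃ * y₂ - q₄ * y₁) * (q₁ * y₄ + q₂ * y₃ - q₃ * y₂ - q₄ * y₁)))
    euler = solve-∀
    factor : ∀ M R S a b c → (M * R + M * S) * (M * R + M * S) + M * (M * (a * a + b * b + c * c))
      ≡ M * (M * ((R + S) * (R + S) + a * a + b * b + c * c))
    factor = solve-∀

  even-or-odd : ∀ n → ∃ λ h → n ≡ h ℕ.+ h ⊎ n ≡ suc (h ℕ.+ h)
  even-or-odd zero = zero , inj₁ refl
  even-or-odd (suc n) with even-or-odd n
  ... | h , inj₁ n≡2h   = h , inj₂ (cong suc n≡2h)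
  ... | h , inj₂ n≡2h+1 = suc h , inj₁ (trans (cong suc n≡2h+1) (cong suc (sym (ℕP.+-suc h h))))

  module _ {p : ℕ} (prime-p : Prime p) where
    private instance
      p≢0 : ℕ.NonZero p
      p≢0 = prime⇒nonZero prime-p

    small-factor-vanishes : ∀ z w K → ∣ z ∣ ℕ.< p → ∣ w ∣ ℕ.< p →
      z * w ≡ K * + p → z ≡ 0ℤ ⊎ w ≡ 0ℤ
    small-factor-vanishes z w K z<p w<p zw≡Kp =
      Sum.map (below z z<p) (below w w<p) (euclidsLemma ∣ z ∣ ∣ w ∣ prime-p p∣zw)
      where
      p∣zw : p Div.∣ ∣ z ∣ ℕ.* ∣ w ∣
      p∣zw = divides ∣ K ∣ (begin
        ∣ z ∣ ℕ.* ∣ w ∣ ≡⟨ ℤP.abs-* z w ⟨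
        ∣ z * w ∣       ≡⟨ cong ∣_∣ zw≡Kp ⟩
        ∣ K * + p ∣     ≡⟨ ℤP.abs-* K (+ p) ⟩
        ∣ K ∣ ℕ.* p     ∎)
      below : ∀ z → ∣ z ∣ ℕ.< p → p Div.∣ ∣ z ∣ → z ≡ 0ℤ
      below (+ zero)   _   _   = refl
      below (+ suc n)  n<p p∣n = ⊥-elim (>⇒∤ n<p p∣n)
      below ℤ.-[1+ n ] n<p p∣n = ⊥-elim (>⇒∤ n<p p∣n)

    squares-incongruent : ∀ {h} → p ≡ suc (h ℕ.+ h) → ∀ a a' K → a ℕ.≤ h → a' ℕ.≤ h →
      + a * + a - + a' * + a' ≡ K * + p → a ≡ a'
    squares-incongruent {h} p≡2h+1 a a' K a≤h a'≤h a²-a'²≡Kp =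
      [ from-difference , from-sum ]′
        (small-factor-vanishes (+ a - + a') (+ a + + a') K difference<p sum<p
          (trans (factor (+ a) (+ a')) a²-a'²≡Kp))
      where
      factor : ∀ a a' → (a - a') * (a + a') ≡ a * a - a' * a'
      factor = solve-∀
      h<p : h ℕ.< p
      h<p = subst (h ℕ.<_) (sym p≡2h+1) (s≤s (ℕP.m≤m+n h h))
      difference<p : ∣ + a - + a' ∣ ℕ.< p
      difference<p = ℕP.≤-<-trans
        (subst (ℕ._≤ a ℕ.⊔ a') (cong ∣_∣ (sym (ℤP.m-n≡m⊖n a a'))) (ℤP.∣m⊝n∣≤m⊔n a a'))
        (ℕP.≤-<-trans (ℕP.⊔-lub a≤h a'≤h) h<p)
      sum<p : ∣ + a + + a' ∣ ℕ.< p
      sum<p = subst (λ s → ∣ s ∣ ℕ.< p) (ℤP.pos-+ a a')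
        (subst (a ℕ.+ a' ℕ.<_) (sym p≡2h+1) (s≤s (ℕP.+-mono-≤ a≤h a'≤h)))
      from-difference : + a - + a' ≡ 0ℤ → a ≡ a'
      from-difference d≡0 = ℤP.+-injective (ℤP.i-j≡0⇒i≡j (+ a) (+ a') d≡0)
      from-sum : + a + + a' ≡ 0ℤ → a ≡ a'
      from-sum s≡0 = trans (ℕP.m+n≡0⇒m≡0 a a+a'≡0) (sym (ℕP.m+n≡0⇒n≡0 a a+a'≡0))
        where
        a+a'≡0 : a ℕ.+ a' ≡ 0
        a+a'≡0 = ℤP.+-injective (trans (ℤP.pos-+ a a') s≡0)

    -- For p = 2h + 1 there are a, b ≤ h with p ∣ a² + b² + 1: the h + 1 numbers a² and the
    -- h + 1 numbers -1 - b² are p + 1 values, so two of them are congruent modulo p.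
    minus-one-sum-of-two-squares : ∀ {h} → p ≡ suc (h ℕ.+ h) →
      ∃₂ λ a b → a ℕ.≤ h × b ℕ.≤ h × ∃ λ K → + a * + a + + b * + b + 1ℤ ≡ K * + p
    minus-one-sum-of-two-squares {h} p≡2h+1 =
      let i , j , i<j , same = FinP.pigeonhole p<2h+2 residue
          u = Fin.splitAt (suc h) i
          v = Fin.splitAt (suc h) j
      in collision u v (λ u≡v → FinP.<⇒≢ i<j (splitAt-injective u≡v))
           (value u /ℕ p - value v /ℕ p) (equal-remainders (value u) (value v) p
             (FinP.fromℕ<-injective (value u %ℕ p) (value v %ℕ p) _ _ same))
      where
      Solution : Set
      Solution = ∃₂ λ a b → a ℕ.≤ h × b ℕ.≤ h × ∃ λ K → + a * + a + + b * + b + 1ℤ ≡ K * + p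
      value : Fin (suc h) ⊎ Fin (suc h) → ℤ
      value (inj₁ i) = + toℕ i * + toℕ i
      value (inj₂ j) = - (1ℤ + + toℕ j * + toℕ j)
      residue : Fin (suc h ℕ.+ suc h) → Fin p
      residue k = fromℕ< (n%ℕd<d (value (Fin.splitAt (suc h) k)) p)
      p<2h+2 : p ℕ.< suc h ℕ.+ suc h
      p<2h+2 = s≤s (ℕP.≤-reflexive (trans p≡2h+1 (sym (ℕP.+-suc h h))))
      splitAt-injective : ∀ {i j} → Fin.splitAt (suc h) i ≡ Fin.splitAt (suc h) j → i ≡ j
      splitAt-injective {i} {j} eq = begin
        i                                           ≡⟨ FinP.join-splitAt (suc h) (suc h) i ⟨
        Fin.join (suc h) (suc h) (Fin.splitAt (suc h) i) ≡⟨ cong (Fin.join (suc h) (suc h)) eq ⟩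
        Fin.join (suc h) (suc h) (Fin.splitAt (suc h) j) ≡⟨ FinP.join-splitAt (suc h) (suc h) j ⟩
        j ∎
      ≤h : (i : Fin (suc h)) → toℕ i ℕ.≤ h
      ≤h i = ℕP.≤-pred (FinP.toℕ<n i)
      collision : ∀ u v → u ≢ v → ∀ K → value u - value v ≡ K * + p → Solution
      collision (inj₁ i) (inj₁ i') i≢i' K eq =
        ⊥-elim (i≢i' (cong inj₁ (FinP.toℕ-injective
          (squares-incongruent p≡2h+1 (toℕ i) (toℕ i') K (≤h i) (≤h i') eq))))
      collision (inj₂ j) (inj₂ j') j≢j' K eq =
        ⊥-elim (j≢j' (cong inj₂ (FinP.toℕ-injective (sym
          (squares-incongruent p≡2h+1 (toℕ j') (toℕ j) K (≤h j') (≤h j)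
            (trans (sym (swap (+ toℕ j * + toℕ j) (+ toℕ j' * + toℕ j'))) eq))))))
        where
        swap : ∀ x y → - (1ℤ + x) - - (1ℤ + y) ≡ y - x
        swap = solve-∀
      collision (inj₁ i) (inj₂ j) _ K eq =
        toℕ i , toℕ j , ≤h i , ≤h j , K , trans (regroup (+ toℕ i * + toℕ i) (+ toℕ j * + toℕ j)) eq
        where
        regroup : ∀ x y → x + y + 1ℤ ≡ x - - (1ℤ + y)
        regroup = solve-∀
      collision (inj₂ j) (inj₁ i) _ K eq =
        toℕ i , toℕ j , ≤h i , ≤h j , - K , (begin
          + toℕ i * + toℕ i + + toℕ j * + toℕ j + 1ℤ
            ≡⟨ regroup (+ toℕ i * + toℕ i) (+ toℕ j * + toℕ j) ⟩
          - (value (inj₂ j) - value (inj₁ i))      ≡⟨ cong -_ eq ⟩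
          - (K * + p)                              ≡⟨ ℤP.neg-distribˡ-* K (+ p) ⟩
          - K * + p                                ∎)
        where
        regroup : ∀ x y → x + y + 1ℤ ≡ - (- (1ℤ + y) - x)
        regroup = solve-∀

    initial-multiple : ∀ {h} → p ≡ suc (h ℕ.+ h) →
      ∃ λ k → 0 ℕ.< k × k ℕ.< p × FourSquares (+ k * + p)
    initial-multiple {zero} p≡1 = ⊥-elim (¬prime[1] (subst Prime p≡1 prime-p))
    initial-multiple {h@(suc g)} p≡2h+1 =
      let a , b , a≤h , b≤h , K , a²+b²+1≡Kp = minus-one-sum-of-two-squares {h} p≡2h+1
          Qx≡Kp : Q (+ a) (+ b) 1ℤ 0ℤ ≡ K * + p
          Qx≡Kp = trans (drop-zero (+ a) (+ b)) a²+b²+1≡Kp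
          n = normQ (+ a) (+ b) 1ℤ 0ℤ
          n≡Kp : n ≡ ∣ K ∣ ℕ.* p
          n≡Kp = trans (cong ∣_∣ (trans (sym (Q-abs (+ a) (+ b) 1ℤ 0ℤ)) Qx≡Kp)) (ℤP.abs-* K (+ p))
          n<p² : n ℕ.< p ℕ.* p
          n<p² = ℕP.≤-<-trans
                   (ℕP.+-mono-≤ (ℕP.+-mono-≤ (ℕP.+-mono-≤ (square-mono-≤ a≤h) (square-mono-≤ b≤h))
                     ℕP.≤-refl) ℕP.≤-refl)
                   (subst (Qℕ h h 1 0 ℕ.<_) (cong (λ q → q ℕ.* q) (sym p≡2h+1)) (odd-square g))
      in ∣ K ∣ , positive a b (∣ K ∣) n≡Kp ,
         ℕP.*-cancelʳ-< p (∣ K ∣) p (subst (ℕ._< p ℕ.* p) n≡Kp n<p²) ,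
         + a , + b , 1ℤ , 0ℤ ,
         trans (Q-abs (+ a) (+ b) 1ℤ 0ℤ) (trans (cong +_ n≡Kp) (ℤP.pos-* (∣ K ∣) p))
      where
      drop-zero : ∀ x y → x * x + y * y + 1ℤ * 1ℤ + 0ℤ * 0ℤ ≡ x * x + y * y + 1ℤ
      drop-zero = solve-∀
      positive : ∀ a b k → Qℕ a b 1 0 ≡ k ℕ.* p → 0 ℕ.< k
      positive a b zero eq with Qℕ-zero a b 1 0 eq
      ... | _ , _ , () , _
      positive a b (suc k) _ = z<s
      odd-square : ∀ g → Qℕ (suc g) (suc g) 1 0 ℕ.< suc (suc g ℕ.+ suc g) ℕ.* suc (suc g ℕ.+ suc g)
      odd-square g = subst (Qℕ (suc g) (suc g) 1 0 ℕ.<_) (sym (expand g)) (ℕP.m<m+n _ z<s)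
        where
        expand : ∀ g → suc (suc g ℕ.+ suc g) ℕ.* suc (suc g ℕ.+ suc g)
          ≡ (suc g ℕ.* suc g ℕ.+ suc g ℕ.* suc g ℕ.+ 1 ℕ.* 1 ℕ.+ 0 ℕ.* 0)
            ℕ.+ suc (5 ℕ.+ 8 ℕ.* g ℕ.+ 2 ℕ.* (g ℕ.* g))
        expand = ℕSolver.solve-∀

    not-square-multiple : ∀ {m} → 1 ℕ.< m → m ℕ.< p → ∀ K → + m * + p ≢ + m * (+ m * K)
    not-square-multiple {m} 1<m m<p K eq =
      [ (λ m≡1 → ℕP.<-irrefl (sym m≡1) 1<m) , (λ m≡p → ℕP.<-irrefl m≡p m<p) ]′
        (prime⇒irreducible prime-p m∣p)
      where
      instance
        m≢0 : ℕ.NonZero m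
        m≢0 = ℕ.>-nonZero (ℕP.<-trans z<s 1<m)
      m∣p : m Div.∣ p
      m∣p = divides ∣ K ∣ (begin
        p            ≡⟨ cong ∣_∣ (ℤP.*-cancelˡ-≡ (+ m) (+ p) (+ m * K) eq) ⟩
        ∣ + m * K ∣  ≡⟨ ℤP.abs-* (+ m) K ⟩
        m ℕ.* ∣ K ∣  ≡⟨ ℕP.*-comm m ∣ K ∣ ⟩
        ∣ K ∣ ℕ.* m  ∎)

    -- If all four numbers xᵢ are congruent modulo m to one c with 2c ≡ 0 (mod m),
    -- then m² ∣ Q x, so Q x ≠ m·p.
    congruent-impossible : ∀ {m y₁ y₂ y₃ y₄} → 1 ℕ.< m → m ℕ.< p →
      ∀ c e q₁ q₂ q₃ q₄ → y₁ ≡ c → y₂ ≡ c → y₃ ≡ c → y₄ ≡ c → c + c ≡ e * + m →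
      Q (y₁ + q₁ * + m) (y₂ + q₂ * + m) (y₃ + q₃ * + m) (y₄ + q₄ * + m) ≢ + m * + p
    congruent-impossible {m} 1<m m<p c e q₁ q₂ q₃ q₄ refl refl refl refl 2c≡em Qx≡mp =
      not-square-multiple 1<m m<p _ (trans (sym Qx≡mp) (common-residue c e q₁ q₂ q₃ q₄ (+ m) 2c≡em))

    -- Boundary case Q y = 0 of the descent: all residues vanish.
    vanishing-residues-impossible : ∀ {m y₁ y₂ y₃ y₄} → 1 ℕ.< m → m ℕ.< p → ∀ q₁ q₂ q₃ q₄ →
      normQ y₁ y₂ y₃ y₄ ≡ 0 →
      Q (y₁ + q₁ * + m) (y₂ + q₂ * + m) (y₃ + q₃ * + m) (y₄ + q₄ * + m) ≢ + m * + p
    vanishing-residues-impossible {m} {y₁} {y₂} {y₃} {y₄} 1<m m<p q₁ q₂ q₃ q₄ N≡0 =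
      let u₁≡0 , u₂≡0 , u₃≡0 , u₄≡0 = Qℕ-zero (∣ y₁ ∣) (∣ y₂ ∣) (∣ y₃ ∣) (∣ y₄ ∣) N≡0
      in congruent-impossible {m} {y₁} {y₂} {y₃} {y₄} 1<m m<p 0ℤ 0ℤ q₁ q₂ q₃ q₄
           (ℤP.∣i∣≡0⇒i≡0 u₁≡0) (ℤP.∣i∣≡0⇒i≡0 u₂≡0) (ℤP.∣i∣≡0⇒i≡0 u₃≡0) (ℤP.∣i∣≡0⇒i≡0 u₄≡0) refl

    -- Boundary case Q y = m² of the descent: every residue equals m/2.
    half-residues-impossible : ∀ {m y₁ y₂ y₃ y₄} → 1 ℕ.< m → m ℕ.< p → ∀ q₁ q₂ q₃ q₄ →
      LeastResidue m y₁ → LeastResidue m y₂ → LeastResidue m y₃ → LeastResidue m y₄ →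
      normQ y₁ y₂ y₃ y₄ ≡ m ℕ.* m →
      Q (y₁ + q₁ * + m) (y₂ + q₂ * + m) (y₃ + q₃ * + m) (y₄ + q₄ * + m) ≢ + m * + p
    half-residues-impossible {m} {y₁} {y₂} {y₃} {y₄} 1<m m<p q₁ q₂ q₃ q₄
      (b₁ , top₁) (b₂ , top₂) (b₃ , top₃) (b₄ , top₄) N≡m² =
      let 2u₁≡m , 2u₂≡m , 2u₃≡m , 2u₄≡m = Qℕ-tight _ _ _ _ b₁ b₂ b₃ b₄ (begin
            Qℕ (u₁ ℕ.+ u₁) (u₂ ℕ.+ u₂) (u₃ ℕ.+ u₃) (u₄ ℕ.+ u₄) ≡⟨ Qℕ-double u₁ u₂ u₃ u₄ ⟨
            4 ℕ.* normQ y₁ y₂ y₃ y₄                         ≡⟨ cong (4 ℕ.*_) N≡m² ⟩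
            4 ℕ.* (m ℕ.* m)                                 ≡⟨ Qℕ-diagonal m ⟩
            Qℕ m m m m                                      ∎)
          equal : ∀ {y} → ∣ y ∣ ℕ.+ ∣ y ∣ ≡ m → (∣ y ∣ ℕ.+ ∣ y ∣ ≡ m → y ≡ + ∣ y ∣) → y ≡ + u₁
          equal {y} 2u≡m top = trans (top 2u≡m) (cong +_ (half-unique (trans 2u≡m (sym 2u₁≡m))))
      in congruent-impossible {m} {y₁} {y₂} {y₃} {y₄} 1<m m<p (+ u₁) 1ℤ q₁ q₂ q₃ q₄
           (equal 2u₁≡m top₁) (equal 2u₂≡m top₂) (equal 2u₃≡m top₃) (equal 2u₄≡m top₄)
           (trans (sym (ℤP.pos-+ u₁ u₁)) (trans (cong +_ 2u₁≡m) (sym (ℤP.*-identityˡ (+ m)))))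
      where
      u₁ u₂ u₃ u₄ : ℕ
      u₁ = ∣ y₁ ∣
      u₂ = ∣ y₂ ∣
      u₃ = ∣ y₃ ∣
      u₄ = ∣ y₄ ∣
      half-unique : ∀ {a b} → a ℕ.+ a ≡ b ℕ.+ b → a ≡ b
      half-unique {a} {b} eq = ℕP.*-cancelˡ-≡ a b 2 (trans (double a) (trans eq (sym (double b))))
        where
        double : ∀ a → 2 ℕ.* a ≡ a ℕ.+ a
        double = ℕSolver.solve-∀

    -- The descent step for chosen least residues yᵢ of xᵢ modulo m: here Q y = m·r with
    -- r ≤ m; r = 0 and r = m are impossible, and otherwise Euler's identity represents r·p.
    descend : ∀ {m y₁ y₂ y₃ y₄} → 1 ℕ.< m → m ℕ.< p → ∀ q₁ q₂ q₃ q₄ →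
      LeastResidue m y₁ → LeastResidue m y₂ → LeastResidue m y₃ → LeastResidue m y₄ →
      Q (y₁ + q₁ * + m) (y₂ + q₂ * + m) (y₃ + q₃ * + m) (y₄ + q₄ * + m) ≡ + m * + p →
      ∀ r → normQ y₁ y₂ y₃ y₄ ≡ m ℕ.* r → ∃ λ r → 0 ℕ.< r × r ℕ.< m × FourSquares (+ r * + p)
    descend {m} {y₁} {y₂} {y₃} {y₄} 1<m m<p q₁ q₂ q₃ q₄ _ _ _ _ Qx≡mp zero N≡0 =
      ⊥-elim (vanishing-residues-impossible {m} {y₁} {y₂} {y₃} {y₄} 1<m m<p q₁ q₂ q₃ q₄
               (trans N≡0 (ℕP.*-zeroʳ m)) Qx≡mp)
    descend {m} {y₁} {y₂} {y₃} {y₄} 1<m@(s≤s (s≤s z≤n)) m<p q₁ q₂ q₃ q₄ res₁ res₂ res₃ res₄ Qx≡mp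
      r@(suc _) N≡mr
      with ℕP.m≤n⇒m<n∨m≡n (ℕP.*-cancelˡ-≤ m (subst (ℕ._≤ m ℕ.* m) N≡mr (residues-bound res₁ res₂ res₃ res₄)))
    ... | inj₂ r≡m = ⊥-elim (half-residues-impossible 1<m m<p q₁ q₂ q₃ q₄ res₁ res₂ res₃ res₄
                               (trans N≡mr (cong (m ℕ.*_) r≡m)) Qx≡mp)
    ... | inj₁ r<m = r , z<s , r<m ,
      descent-identity y₁ y₂ y₃ y₄ q₁ q₂ q₃ q₄ (+ m) (+ p) (+ r) Qx≡mp
        (trans (Q-abs y₁ y₂ y₃ y₄) (trans (cong +_ N≡mr) (ℤP.pos-* m r)))

    descent-step : ∀ {m} → 1 ℕ.< m → m ℕ.< p → FourSquares (+ m * + p) →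
      ∃ λ r → 0 ℕ.< r × r ℕ.< m × FourSquares (+ r * + p)
    descent-step {m} 1<m@(s≤s (s≤s z≤n)) m<p (x₁ , x₂ , x₃ , x₄ , Qx≡mp)
      with least-residue x₁ m | least-residue x₂ m | least-residue x₃ m | least-residue x₄ m
    ... | y₁ , q₁ , refl , res₁ | y₂ , q₂ , refl , res₂ | y₃ , q₃ , refl , res₃ | y₄ , q₄ , refl , res₄ =
      let R , Qy≡mR = shifted-multiple y₁ y₂ y₃ y₄ q₁ q₂ q₃ q₄ (+ m) (+ p) Qx≡mp
      in descend 1<m m<p q₁ q₂ q₃ q₄ res₁ res₂ res₃ res₄ Qx≡mp ∣ R ∣
           (trans (cong ∣_∣ (trans (sym (Q-abs y₁ y₂ y₃ y₄)) Qy≡mR)) (ℤP.abs-* (+ m) R))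

    descent : ∀ k → 0 ℕ.< k → k ℕ.< p → FourSquares (+ k * + p) → FourSquares (+ p)
    descent = <-rec Goal step
      where
      Goal : ℕ → Set
      Goal k = 0 ℕ.< k → k ℕ.< p → FourSquares (+ k * + p) → FourSquares (+ p)
      step : ∀ k → (∀ {j} → j ℕ.< k → Goal j) → Goal k
      step (suc zero) _ _ _ s = subst FourSquares (ℤP.*-identityˡ (+ p)) s
      step k@(suc (suc _)) smaller _ k<p s =
        let j , 0<j , j<k , s′ = descent-step (s≤s (s≤s z≤n)) k<p s
        in smaller j<k 0<j (ℕP.<-trans j<k k<p) s′

  even-prime : ∀ {p h} → Prime p → p ≡ h ℕ.+ h → 2 ≡ p
  even-prime {p} {h} prime-p p≡2h =
    [ (λ ()) , (λ 2≡p → 2≡p) ]′ (prime⇒irreducible prime-p (divides h (trans p≡2h (double h))))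
    where
    double : ∀ h → h ℕ.+ h ≡ h ℕ.* 2
    double = ℕSolver.solve-∀

  prime-four-squares : ∀ {p} → Prime p → FourSquares (+ p)
  prime-four-squares {p} prime-p with even-or-odd p
  ... | h , inj₁ p≡2h =
    subst (λ n → FourSquares (+ n)) (even-prime {h = h} prime-p p≡2h) (1ℤ , 1ℤ , 0ℤ , 0ℤ , refl)
  ... | h , inj₂ p≡2h+1 =
    let k , 0<k , k<p , s = initial-multiple prime-p {h} p≡2h+1 in descent prime-p k 0<k k<p s

  lagrange : ∀ n → FourSquares (+ n)
  lagrange = <-rec (λ n → FourSquares (+ n)) step
    where
    step : ∀ n → (∀ {k} → k ℕ.< n → FourSquares (+ k)) → FourSquares (+ n)
    step zero _ = 0ℤ , 0ℤ , 0ℤ , 0ℤ , refl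
    step (suc zero) _ = 1ℤ , 0ℤ , 0ℤ , 0ℤ , refl
    step n@(suc (suc _)) smaller with composite? n
    ... | no ¬composite = prime-four-squares (prime ¬composite)
    ... | yes (hasNonTrivialDivisor {d} d<n d∣n@(divides q n≡qd)) =
      subst FourSquares (sym (trans (cong +_ n≡qd) (ℤP.pos-* q d)))
        (four-squares-* (smaller (quotient-< d∣n)) (smaller d<n))

module Solutions where
  open import Defs
  open Lagrange using (lagrange; square-abs)
  open import Data.Nat as ℕ using (ℕ; zero; suc; z≤n; s≤s)
  import Data.Nat.Properties as ℕP
  open import Data.Integer using (ℤ; +_; -[1+_]; ∣_∣; _*_; _+_; _-_; -_; 0ℤ)
  import Data.Integer.Properties as ℤP
  open import Data.Integer.Tactic.RingSolver using (solve-∀)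
  open import Data.Fin using (Fin; toℕ)
  import Data.Fin.Properties as FinP
  open import Data.Vec as Vec using (Vec; []; _∷_; _++_; splitAt)
  import Data.Vec.Properties as VecP
  open import Data.Vec.Relation.Unary.All using (All; []; _∷_)
  open import Data.List as List using (List; length; upTo; concatMap; filter; deduplicate)
  open import Data.List.Membership.Propositional using (_∈_)
  open import Data.List.Membership.Propositional.Properties
    using ( ∈-map⁺; ∈-++⁺ˡ; ∈-++⁺ʳ; ∈-upTo⁺; ∈-concatMap⁺; ∈-filter⁺; ∈-filter⁻
          ; ∈-deduplicate⁺; ∈-deduplicate⁻)
  open import Data.List.Relation.Unary.Any as Any using (here)
  import Data.List.Relation.Unary.Any.Properties as AnyP
  open import Data.List.Relation.Unary.Unique.Propositional using (Unique)
  import Data.List.Relation.Unary.Unique.DecPropositional.Properties as UniqueP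
  open import Data.Product using (Σ; _×_; _,_; proj₁; proj₂)
  open import Data.Sum using (inj₁; inj₂)
  open import Function.Bundles using (_⇔_; mk⇔; Equivalence)
  open import Relation.Unary using (Decidable)
  open import Relation.Binary.Definitions using (DecidableEquality)
  open import Relation.Binary.PropositionalEquality
  open ≡-Reasoning

  exact-list : ∀ {A : Set} {P : A → Set} → DecidableEquality A → Decidable P →
    (C : List A) → (∀ a → P a → a ∈ C) → Σ (List A) λ L → Unique L × (∀ a → P a ⇔ a ∈ L)
  exact-list _≟_ P? C complete =
    deduplicate _≟_ (filter P? C) , UniqueP.deduplicate-! _≟_ (filter P? C) ,
    λ a → mk⇔ (λ Pa → ∈-deduplicate⁺ _≟_ (∈-filter⁺ P? (complete a Pa) Pa))
              (λ a∈L → proj₂ (∈-filter⁻ P? {xs = C} (∈-deduplicate⁻ _≟_ (filter P? C) a∈L)))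

  injection-≤-length : ∀ {A : Set} {k} {L : List A} (f : Fin k → A) →
    (∀ {i j} → f i ≡ f j → i ≡ j) → (∀ i → f i ∈ L) → k ℕ.≤ length L
  injection-≤-length {L = L} f f-injective f∈L =
    FinP.injective⇒≤ {f = λ i → Any.index (f∈L i)} λ {i} {j} same → f-injective (begin
      f i                              ≡⟨ AnyP.lookup-index (f∈L i) ⟩
      List.lookup L (Any.index (f∈L i)) ≡⟨ cong (List.lookup L) same ⟩
      List.lookup L (Any.index (f∈L j)) ≡⟨ AnyP.lookup-index (f∈L j) ⟨
      f j                              ∎)

  normSq : ∀ {k} → Vec ℤ k → ℕ
  normSq []      = 0
  normSq (a ∷ v) = ∣ a ∣ ℕ.* ∣ a ∣ ℕ.+ normSq v

  sumSq≡normSq : ∀ {k} (v : Vec ℤ k) → sumSq v ≡ + normSq v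
  sumSq≡normSq []      = refl
  sumSq≡normSq (a ∷ v) =
    trans (cong₂ _+_ (square-abs a) (sumSq≡normSq v)) (sym (ℤP.pos-+ (∣ a ∣ ℕ.* ∣ a ∣) (normSq v)))

  height²≤normSq : ∀ {k} (v : Vec ℤ k) → height v ℕ.* height v ℕ.≤ normSq v
  height²≤normSq []      = z≤n
  height²≤normSq (a ∷ v) with ℕP.≤-total ∣ a ∣ (height v)
  ... | inj₁ ∣a∣≤h rewrite ℕP.m≤n⇒m⊔n≡n ∣a∣≤h = ℕP.≤-trans (height²≤normSq v) (ℕP.m≤n+m (normSq v) _)
  ... | inj₂ h≤∣a∣ rewrite ℕP.m≥n⇒m⊔n≡m h≤∣a∣ = ℕP.m≤m+n _ (normSq v)

  n≤n*n : ∀ n → n ℕ.≤ n ℕ.* n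
  n≤n*n zero    = z≤n
  n≤n*n (suc n) = ℕP.m≤m*n (suc n) (suc n)

  entries-bounded : ∀ {k N} (v : Vec ℤ k) → normSq v ℕ.≤ N → All (λ a → ∣ a ∣ ℕ.≤ N) v
  entries-bounded []      _ = []
  entries-bounded (a ∷ v) ‖v‖²≤N =
    ℕP.≤-trans (n≤n*n ∣ a ∣) (ℕP.≤-trans (ℕP.m≤m+n _ (normSq v)) ‖v‖²≤N) ∷
    entries-bounded v (ℕP.≤-trans (ℕP.m≤n+m (normSq v) _) ‖v‖²≤N)

  interval : ℕ → List ℤ
  interval N = List.map +_ (upTo (suc N)) List.++ List.map (λ i → - + i) (upTo (suc N))

  ∈-interval : ∀ {N} a → ∣ a ∣ ℕ.≤ N → a ∈ interval N
  ∈-interval {N} (+ i)      i≤N = ∈-++⁺ˡ (∈-map⁺ +_ (∈-upTo⁺ (s≤s i≤N)))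
  ∈-interval {N} -[1+ i ] i<N =
    ∈-++⁺ʳ (List.map +_ (upTo (suc N))) (∈-map⁺ (λ i → - + i) (∈-upTo⁺ (s≤s i<N)))

  cube : ∀ k → ℕ → List (Vec ℤ k)
  cube zero    N = List.[ [] ]
  cube (suc k) N = concatMap (λ a → List.map (a ∷_) (cube k N)) (interval N)

  ∈-cube : ∀ {k N} {v : Vec ℤ k} → All (λ a → ∣ a ∣ ℕ.≤ N) v → v ∈ cube k N
  ∈-cube []                  = here refl
  ∈-cube {suc k} {N} {a ∷ v} (∣a∣≤N ∷ bounded) =
    ∈-concatMap⁺ (λ b → List.map (b ∷_) (cube k N))
      (Any.map (λ { refl → ∈-map⁺ (a ∷_) (∈-cube bounded) }) (∈-interval a ∣a∣≤N))

  splitAt-++ : ∀ {A : Set} {n} m (xs : Vec A m) (ys : Vec A n) →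
    splitAt m (xs ++ ys) ≡ (xs , ys , refl)
  splitAt-++ zero    []       ys = refl
  splitAt-++ (suc m) (x ∷ xs) ys rewrite splitAt-++ m xs ys = refl

  split : ∀ {n} (y : Vec ℤ (n ℕ.+ 8)) →
    Σ (Vec ℤ n) λ x → Σ (Vec ℤ 4) λ s → Σ (Vec ℤ 4) λ t → y ≡ x ++ (s ++ t)
  split {n} y with splitAt n y
  ... | x , st , refl with splitAt 4 st
  ...   | s , t , refl = x , s , t , refl

  E-++ : ∀ {n} (D : Poly n) (x : Vec ℤ n) (s t : Vec ℤ 4) → E D (x ++ (s ++ t)) ≡
    eval D x * eval D x + (sumSq x - sumSq s - sumSq t) * (sumSq x - sumSq s - sumSq t)
  E-++ {n} D x s t rewrite splitAt-++ n x (s ++ t) | splitAt-++ 4 s t = refl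

  squares-zero : ∀ a b → a * a + b * b ≡ 0ℤ → a ≡ 0ℤ × b ≡ 0ℤ
  squares-zero a b a²+b²≡0 = root a (ℕP.m+n≡0⇒m≡0 _ sum≡0) , root b (ℕP.m+n≡0⇒n≡0 _ sum≡0)
    where
    sum≡0 : ∣ a ∣ ℕ.* ∣ a ∣ ℕ.+ ∣ b ∣ ℕ.* ∣ b ∣ ≡ 0
    sum≡0 = ℤP.+-injective (begin
      + (∣ a ∣ ℕ.* ∣ a ∣ ℕ.+ ∣ b ∣ ℕ.* ∣ b ∣)   ≡⟨ ℤP.pos-+ (∣ a ∣ ℕ.* ∣ a ∣) _ ⟩
      + (∣ a ∣ ℕ.* ∣ a ∣) + + (∣ b ∣ ℕ.* ∣ b ∣) ≡⟨ cong₂ _+_ (square-abs a) (square-abs b) ⟨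
      a * a + b * b                             ≡⟨ a²+b²≡0 ⟩
      0ℤ                                        ∎)
    root : ∀ a → ∣ a ∣ ℕ.* ∣ a ∣ ≡ 0 → a ≡ 0ℤ
    root (+ zero) _ = refl

  E-zero⇔ : ∀ {n} (D : Poly n) (x : Vec ℤ n) (s t : Vec ℤ 4) →
    E D (x ++ (s ++ t)) ≡ 0ℤ ⇔ (eval D x ≡ 0ℤ × sumSq x ≡ sumSq s + sumSq t)
  E-zero⇔ D x s t = mk⇔ to from
    where
    to : E D (x ++ (s ++ t)) ≡ 0ℤ → eval D x ≡ 0ℤ × sumSq x ≡ sumSq s + sumSq t
    to E≡0 =
      let D≡0 , difference≡0 = squares-zero _ _ (trans (sym (E-++ D x s t)) E≡0)
      in D≡0 , balance (sumSq x) (sumSq s) (sumSq t) difference≡0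
      where
      balance : ∀ X S T → X - S - T ≡ 0ℤ → X ≡ S + T
      balance X S T X-S-T≡0 =
        trans (rearrange X S T) (trans (cong (_+ (S + T)) X-S-T≡0) (ℤP.+-identityˡ (S + T)))
        where
        rearrange : ∀ X S T → X ≡ (X - S - T) + (S + T)
        rearrange = solve-∀
    from : eval D x ≡ 0ℤ × sumSq x ≡ sumSq s + sumSq t → E D (x ++ (s ++ t)) ≡ 0ℤ
    from (D≡0 , X≡S+T) rewrite E-++ D x s t | D≡0 | X≡S+T = vanish (sumSq s) (sumSq t)
      where
      vanish : ∀ S T → 0ℤ * 0ℤ + (S + T - S - T) * (S + T - S - T) ≡ 0ℤ
      vanish = solve-∀

  candidates-above : ∀ {n} → Vec ℤ n → List (Vec ℤ (n ℕ.+ 8))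
  candidates-above x =
    concatMap (λ s → List.map (λ t → x ++ (s ++ t)) (cube 4 (normSq x))) (cube 4 (normSq x))

  ∈-candidates-above : ∀ {n} (x : Vec ℤ n) {s t : Vec ℤ 4} →
    All (λ a → ∣ a ∣ ℕ.≤ normSq x) s → All (λ a → ∣ a ∣ ℕ.≤ normSq x) t →
    x ++ (s ++ t) ∈ candidates-above x
  ∈-candidates-above x {s} {t} s-bounded t-bounded =
    ∈-concatMap⁺ (λ s → List.map (λ t → x ++ (s ++ t)) (cube 4 (normSq x)))
      (Any.map (λ { refl → ∈-map⁺ (λ t → x ++ (s ++ t)) (∈-cube t-bounded) }) (∈-cube s-bounded))

  candidates : ∀ {n} → List (Vec ℤ n) → List (Vec ℤ (n ℕ.+ 8))
  candidates = concatMap candidates-above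

  candidates-complete : ∀ {n} (D : Poly n) (roots : List (Vec ℤ n)) →
    (∀ x → eval D x ≡ 0ℤ → x ∈ roots) → ∀ y → E D y ≡ 0ℤ → y ∈ candidates roots
  candidates-complete D roots complete y E≡0 with split y
  ... | x , s , t , refl =
    ∈-concatMap⁺ candidates-above
      (Any.map (λ { refl → ∈-candidates-above x (entries-bounded s ‖s‖²≤‖x‖²)
                                                (entries-bounded t ‖t‖²≤‖x‖²) })
        (complete x D≡0))
    where
    D≡0 : eval D x ≡ 0ℤ
    D≡0 = proj₁ (Equivalence.to (E-zero⇔ D x s t) E≡0)
    ‖x‖²≡ : normSq x ≡ normSq s ℕ.+ normSq t
    ‖x‖²≡ = ℤP.+-injective (begin
      + normSq x                  ≡⟨ sumSq≡normSq x ⟨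
      sumSq x                     ≡⟨ proj₂ (Equivalence.to (E-zero⇔ D x s t) E≡0) ⟩
      sumSq s + sumSq t           ≡⟨ cong₂ _+_ (sumSq≡normSq s) (sumSq≡normSq t) ⟩
      + normSq s + + normSq t     ≡⟨ ℤP.pos-+ (normSq s) (normSq t) ⟨
      + (normSq s ℕ.+ normSq t)   ∎)
    ‖s‖²≤‖x‖² : normSq s ℕ.≤ normSq x
    ‖s‖²≤‖x‖² = subst (normSq s ℕ.≤_) (sym ‖x‖²≡) (ℕP.m≤m+n _ _)
    ‖t‖²≤‖x‖² : normSq t ℕ.≤ normSq x
    ‖t‖²≤‖x‖² = subst (normSq t ℕ.≤_) (sym ‖x‖²≡) (ℕP.m≤n+m _ _)

  four-squares-vec : ∀ N → Σ (Vec ℤ 4) λ t → sumSq t ≡ + N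
  four-squares-vec N =
    let a , b , c , d , Q≡N = lagrange N in a ∷ b ∷ c ∷ d ∷ [] , trans (regroup a b c d) Q≡N
    where
    regroup : ∀ a b c d → a * a + (b * b + (c * c + (d * d + + 0))) ≡ a * a + b * b + c * c + d * d
    regroup = solve-∀

  -- A root x₀ of D of height h yields h + 1 distinct solutions x₀ ++ (k, 0, 0, 0) ++ tₖ of
  -- E D = 0 (0 ≤ k ≤ h), where ‖tₖ‖² = ‖x₀‖² - k² ≥ 0 by Lagrange's theorem.
  many-solutions : ∀ {n} (D : Poly n) (x₀ : Vec ℤ n) → eval D x₀ ≡ 0ℤ →
    Σ (Fin (suc (height x₀)) → Vec ℤ (n ℕ.+ 8)) λ f →
      (∀ {i j} → f i ≡ f j → i ≡ j) × (∀ i → E D (f i) ≡ 0ℤ)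
  many-solutions D x₀ D≡0 = solution , solution-injective , solves
    where
    first : Fin (suc (height x₀)) → Vec ℤ 4
    first k = + toℕ k ∷ 0ℤ ∷ 0ℤ ∷ 0ℤ ∷ []
    k²≤‖x₀‖² : ∀ k → toℕ k ℕ.* toℕ k ℕ.≤ normSq x₀
    k²≤‖x₀‖² k = ℕP.≤-trans (ℕP.*-mono-≤ k≤h k≤h) (height²≤normSq x₀)
      where
      k≤h : toℕ k ℕ.≤ height x₀
      k≤h = ℕP.≤-pred (FinP.toℕ<n k)
    rest : ∀ k → Σ (Vec ℤ 4) λ t → sumSq t ≡ + (normSq x₀ ℕ.∸ toℕ k ℕ.* toℕ k)
    rest k = four-squares-vec (normSq x₀ ℕ.∸ toℕ k ℕ.* toℕ k)
    solution : Fin (suc (height x₀)) → Vec ℤ _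
    solution k = x₀ ++ (first k ++ proj₁ (rest k))
    solution-injective : ∀ {i j} → solution i ≡ solution j → i ≡ j
    solution-injective {i} {j} same = FinP.toℕ-injective (ℤP.+-injective (cong Vec.head
      (VecP.++-injectiveˡ (first i) (first j) (VecP.++-injectiveʳ x₀ x₀ same))))
    balanced : ∀ k → sumSq x₀ ≡ sumSq (first k) + sumSq (proj₁ (rest k))
    balanced k = begin
      sumSq x₀                                       ≡⟨ sumSq≡normSq x₀ ⟩
      + normSq x₀                                    ≡⟨ cong +_ (ℕP.m+[n∸m]≡n (k²≤‖x₀‖² k)) ⟨
      + (toℕ k ℕ.* toℕ k ℕ.+ (normSq x₀ ℕ.∸ toℕ k ℕ.* toℕ k)) ≡⟨ ℤP.pos-+ (toℕ k ℕ.* toℕ k) _ ⟩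
      + (toℕ k ℕ.* toℕ k) + + (normSq x₀ ℕ.∸ toℕ k ℕ.* toℕ k)
        ≡⟨ cong₂ _+_ (trans (ℤP.pos-* (toℕ k) (toℕ k)) (sym (only-first (+ toℕ k)))) (sym (proj₂ (rest k))) ⟩
      sumSq (first k) + sumSq (proj₁ (rest k))       ∎
      where
      only-first : ∀ a → a * a + (0ℤ * 0ℤ + (0ℤ * 0ℤ + (0ℤ * 0ℤ + + 0))) ≡ a * a
      only-first = solve-∀
    solves : ∀ k → E D (solution k) ≡ 0ℤ
    solves k = Equivalence.from (E-zero⇔ D x₀ (first k) (proj₁ (rest k))) (D≡0 , balanced k)

open import Defs
open import Data.Nat using (ℕ; suc; _+_; _≤_; _<_)
open import Data.Integer using (ℤ; 0ℤ; _≟_)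
open import Data.Vec using (Vec)
open import Data.Vec.Properties using (≡-dec)
open import Data.List using (List; length)
open import Data.List.Membership.Propositional using (_∈_)
open import Data.List.Relation.Unary.Unique.Propositional using (Unique)
open import Data.Product using (Σ; ∃; _×_; _,_)
open import Function.Bundles using (_⇔_; module Equivalence)
open import Relation.Binary.PropositionalEquality using (_≡_; subst)
open Solutions using (exact-list; candidates; candidates-complete; many-solutions; injection-≤-length)

-- The theorem: the solutions of E D = 0 form a finite list without repetitions that is longer
-- than d.
lemma1 : (n : ℕ) (D : Poly n) →
    (∃ λ (x : Vec ℤ n) → eval D x ≡ 0ℤ) →
    (Σ (List (Vec ℤ n)) λ L → ∀ x → eval D x ≡ 0ℤ → x ∈ L) →
    (d : ℕ) →
    (∃ λ (x : Vec ℤ n) → eval D x ≡ 0ℤ × height x ≡ d) →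
    (∀ (x : Vec ℤ n) → eval D x ≡ 0ℤ → height x ≤ d) →
    Σ (List (Vec ℤ (n + 8))) λ L →
    Unique L × (∀ y → (E D y ≡ 0ℤ) ⇔ (y ∈ L)) × d < length L
lemma1 n D _ (roots , roots-complete) d (x₀ , D≡0 , height≡d) _ =
  let L , unique , spec = exact-list (≡-dec _≟_) (λ y → E D y ≟ 0ℤ)
                            (candidates roots) (candidates-complete D roots roots-complete)
      f , f-injective , f-solves = many-solutions D x₀ D≡0
  in L , unique , spec ,
     subst (λ h → suc h ≤ length L) height≡d
       (injection-≤-length f f-injective λ i → Equivalence.to (spec (f i)) (f-solves i))
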